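{- For $n\ge 3$ and $0\le i\le n-1$, $$\widetilde T_{n,i}(x)=x^2\sum_{j=0}^{i-1}T_{n-1,j}(x)+x\sum_{j=i}^{2n-i-3}T_{n-1,j}(x)+\sum_{j=2n-i-2}^{2n-3}T_{n-1,j}(x),$$ and $\widetilde T_{n,2n-i-1}(x)=\widetilde T_{n,i}(x)$.
   Context: $I_n$ is the set of integer sequences $\mathbf e=(e_1,\dots,e_n)$ with $0\le e_i<2i$. For $\mathbf e\in I_n$: $\operatorname{Asc}_D\mathbf e=\{i\in[n-1]: e_i/i<e_{i+1}/(i+1)\}\cup\{0:\text{if } e_1+e_2/2\ge3/2\}$, $\operatorname{asc}_D\mathbf e=|\operatorname{Asc}_D\mathbf e|$, and $\widetilde{\operatorname{asc}}_D\mathbf e=\operatorname{asc}_D\mathbf e+\chi\big(\tfrac{e_{n-1}}{n-1}+\tfrac{e_n}{n}<\tfrac{2n-1}{n}\big)$, where $\chi(\varphi)$ is $1$ if $\varphi$ holds and $0$ otherwise. Define $T_{n,i}(x)=\sum_{\mathbf e\in I_n,\ e_n=i}x^{\operatorname{asc}_D\mathbf e}$ and $\widetilde T_{n,i}(x)=\sum_{\mathbf e\in I_n,\ e_n=i}x^{\widetilde{\operatorname{asc}}_D\mathbf e}$ for $0\le i\le 2n-1$. -}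

module Defs where

open import Data.Nat using (ℕ; zero; suc; _+_; _*_; _∸_; _<ᵇ_; _≡ᵇ_)
open import Data.Bool using (Bool; true; false; _∧_; not)
open import Data.List using (List; []; _∷_; _++_; [_]; map; concatMap; upTo; reverse)
open import Data.Nat.ListAction using (sum)

χ : Bool → ℕ
χ true  = 1
χ false = 0

-- I n : all sequences (e_1,…,e_n) with 0 ≤ e_i < 2i, as lists [e_1,…,e_n].
I : ℕ → List (List ℕ)
I zero    = [] ∷ []
I (suc n) = concatMap (λ e → map (λ x → e ++ [ x ]) (upTo (2 * suc n))) (I n)

-- Ascents i ∈ [n-1] : e_i/i < e_{i+1}/(i+1), i.e. e_i (i+1) < e_{i+1} i.
-- ascsFrom i (e_i ∷ e_{i+1} ∷ …) counts ascents at positions ≥ i.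
ascsFrom : ℕ → List ℕ → ℕ
ascsFrom i (a ∷ b ∷ rest) = χ (a * suc i <ᵇ b * i) + ascsFrom (suc i) (b ∷ rest)
ascsFrom i _              = 0

-- Ascent at 0: e_1 + e_2/2 ≥ 3/2, i.e. 2 e_1 + e_2 ≥ 3 (only when n ≥ 2).
asc0 : List ℕ → ℕ
asc0 (a ∷ b ∷ _) = χ (not (2 * a + b <ᵇ 3))
asc0 _           = 0

ascD : List ℕ → ℕ
ascD e = asc0 e + ascsFrom 1 e

lastE : List ℕ → ℕ
lastE e with reverse e
... | a ∷ _ = a
... | []    = 0

penE : List ℕ → ℕ
penE e with reverse e
... | _ ∷ b ∷ _ = b
... | _         = 0

-- For e ∈ I_n: chi( e_{n-1}/(n-1) + e_n/n < (2n-1)/n ),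
-- i.e. n e_{n-1} + (n-1) e_n < (2n-1)(n-1).
tildeBonus : ℕ → List ℕ → ℕ
tildeBonus n e = χ (n * penE e + (n ∸ 1) * lastE e <ᵇ (2 * n ∸ 1) * (n ∸ 1))

ascDt : ℕ → List ℕ → ℕ
ascDt n e = ascD e + tildeBonus n e

-- Coefficients: T n i k = [x^k] T_{n,i}(x) = #{ e ∈ I_n : e_n = i, asc_D e = k }.
T : ℕ → ℕ → ℕ → ℕ
T n i k = sum (map (λ e → χ ((lastE e ≡ᵇ i) ∧ (ascD e ≡ᵇ k))) (I n))

-- Tt n i k = [x^k] T̃_{n,i}(x).
Tt : ℕ → ℕ → ℕ → ℕ
Tt n i k = sum (map (λ e → χ ((lastE e ≡ᵇ i) ∧ (ascDt n e ≡ᵇ k))) (I n))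

-- Σ_{j = a}^{b-1} f j  (half-open range [a, b); empty if b ≤ a)
sumRange : ℕ → ℕ → (ℕ → ℕ) → ℕ
sumRange a b f = sum (map (λ t → f (a + t)) (upTo (b ∸ a)))

-- coefficient of x^k in x^d · p(x), where p has coefficient function p
shiftCoeff : ℕ → (ℕ → ℕ) → ℕ → ℕ
shiftCoeff zero    p k       = p k
shiftCoeff (suc d) p zero    = 0
shiftCoeff (suc d) p (suc k) = shiftCoeff d p k

module Submission where

-- Every e ∈ I_{m+1} is a sequence e' ∈ I_m extended by a last entry x, and
-- asc̃_D(e) = asc_D(e') + w(j, x), where j is the last entry of e' and the weight
-- w(j, x) ∈ {0, 1, 2} counts the new ascent at position m (j/m < x/(m+1)) and the
-- correction χ(j/m + x/(m+1) < (2m+1)/(m+1)).  For x ≤ m these two conditions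
-- reduce to j < x and j + x < 2m, so grouping e' by j gives the three sums.
-- The reflection x ↦ 2m+1−x exchanges the two conditions, so w and hence T̃
-- are invariant under it.

open import Defs
open import Data.Bool using (Bool; true; false; _∧_)
open import Data.Empty using (⊥-elim)
open import Data.List using (List; []; _∷_; _++_; [_]; map; concatMap; upTo; applyUpTo; reverse; length)
open import Data.List.Properties
  using (map-++; map-∘; map-cong; map-cong-local; map-upTo; reverse-++; unfold-reverse; length-++)
open import Data.List.Relation.Unary.All as All using (All; []; _∷_)
open import Data.List.Relation.Unary.All.Properties using (concat⁺; map⁺; applyUpTo⁺₁; applyUpTo⁺₂)
open import Data.Nat using (ℕ; zero; suc; _+_; _*_; _∸_; _≤_; _<_; _<ᵇ_; _≡ᵇ_; z≤n; s≤s; z<s; s<s)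
open import Data.Nat.ListAction using (sum)
open import Data.Nat.ListAction.Properties using (sum-++)
open import Data.Nat.Properties
open import Algebra.Properties.CommutativeSemigroup +-commutativeSemigroup using (interchange)
open import Data.Product using (_×_; _,_)
open import Function using (_∘_)
open import Relation.Nullary.Reflects using (ofʸ; ofⁿ)
open import Relation.Binary.PropositionalEquality hiding ([_])

∑< : ℕ → (ℕ → ℕ) → ℕ
∑< n f = sum (applyUpTo f n)

∑<-cong : ∀ n {f g : ℕ → ℕ} → (∀ t → t < n → f t ≡ g t) → ∑< n f ≡ ∑< n g
∑<-cong zero    eq = refl
∑<-cong (suc n) eq = cong₂ _+_ (eq 0 z<s) (∑<-cong n (λ t t<n → eq (suc t) (s<s t<n)))

∑<-zero : ∀ n → ∑< n (λ _ → 0) ≡ 0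
∑<-zero zero    = refl
∑<-zero (suc n) = ∑<-zero n

∑<-+ : ∀ n (f g : ℕ → ℕ) → ∑< n (λ t → f t + g t) ≡ ∑< n f + ∑< n g
∑<-+ zero    f g = refl
∑<-+ (suc n) f g = trans (cong (f 0 + g 0 +_) (∑<-+ n (f ∘ suc) (g ∘ suc)))
                         (interchange (f 0) (g 0) (∑< n (f ∘ suc)) (∑< n (g ∘ suc)))

∑<-+-split : ∀ a b (f : ℕ → ℕ) → ∑< (a + b) f ≡ ∑< a f + ∑< b (λ t → f (a + t))
∑<-+-split zero    b f = refl
∑<-+-split (suc a) b f = trans (cong (f 0 +_) (∑<-+-split a b (f ∘ suc))) (sym (+-assoc (f 0) _ _))

∑<-pick : ∀ n v (b : ℕ → Bool) → v < n → ∑< n (λ j → χ ((v ≡ᵇ j) ∧ b j)) ≡ χ (b v)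
∑<-pick (suc n) zero    b _         = trans (cong (χ (b 0) +_) (∑<-zero n)) (+-identityʳ _)
∑<-pick (suc n) (suc v) b (s<s v<n) = ∑<-pick n v (b ∘ suc) v<n

module _ {A : Set} where

  sum-map-zero : ∀ (L : List A) → sum (map (λ _ → 0) L) ≡ 0
  sum-map-zero []      = refl
  sum-map-zero (_ ∷ L) = sum-map-zero L

  sum-map-concatMap : ∀ {B : Set} (f : A → ℕ) (G : B → List A) L →
    sum (map f (concatMap G L)) ≡ sum (map (λ e → sum (map f (G e))) L)
  sum-map-concatMap f G []      = refl
  sum-map-concatMap f G (e ∷ L) = begin
    sum (map f (G e ++ concatMap G L))
      ≡⟨ cong sum (map-++ f (G e) _) ⟩
    sum (map f (G e) ++ map f (concatMap G L))
      ≡⟨ sum-++ (map f (G e)) _ ⟩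
    sum (map f (G e)) + sum (map f (concatMap G L))
      ≡⟨ cong (sum (map f (G e)) +_) (sum-map-concatMap f G L) ⟩
    sum (map f (G e)) + sum (map (λ e → sum (map f (G e))) L) ∎
    where open ≡-Reasoning

  sum-map-∑< : ∀ (F : A → ℕ → ℕ) n L →
    sum (map (λ e → ∑< n (F e)) L) ≡ ∑< n (λ j → sum (map (λ e → F e j) L))
  sum-map-∑< F n []      = sym (∑<-zero n)
  sum-map-∑< F n (e ∷ L) = trans (cong (∑< n (F e) +_) (sum-map-∑< F n L))
                                  (sym (∑<-+ n (F e) (λ j → sum (map (λ e → F e j) L))))

  sum-map-fibres : ∀ (v : A → ℕ) (P : A → ℕ → Bool) {n L} → All (λ e → v e < n) L →
    sum (map (λ e → χ (P e (v e))) L) ≡ ∑< n (λ j → sum (map (λ e → χ ((v e ≡ᵇ j) ∧ P e j)) L))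
  sum-map-fibres v P {n} {L} v<n = trans
    (cong sum (map-cong-local (All.map (λ {e} v<n → sym (∑<-pick n (v e) (P e) v<n)) v<n)))
    (sum-map-∑< (λ e j → χ ((v e ≡ᵇ j) ∧ P e j)) n L)

  shiftCoeff-sum : ∀ d (F : A → ℕ → ℕ) L k →
    shiftCoeff d (λ k → sum (map (λ e → F e k) L)) k ≡ sum (map (λ e → shiftCoeff d (F e) k) L)
  shiftCoeff-sum zero    F L k       = refl
  shiftCoeff-sum (suc d) F L zero    = sym (sum-map-zero L)
  shiftCoeff-sum (suc d) F L (suc k) = shiftCoeff-sum d F L k

χ-∧-shift : ∀ b a d k → χ (b ∧ (d + a ≡ᵇ k)) ≡ shiftCoeff d (λ k → χ (b ∧ (a ≡ᵇ k))) k
χ-∧-shift b     a zero    k       = refl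
χ-∧-shift true  a (suc d) zero    = refl
χ-∧-shift false a (suc d) zero    = refl
χ-∧-shift b     a (suc d) (suc k) = χ-∧-shift b a d k

sum-map-χ-shift : ∀ {A : Set} (p : A → Bool) (a : A → ℕ) d k L →
  sum (map (λ e → χ (p e ∧ (d + a e ≡ᵇ k))) L) ≡
  shiftCoeff d (λ k → sum (map (λ e → χ (p e ∧ (a e ≡ᵇ k))) L)) k
sum-map-χ-shift p a d k L = trans (cong sum (map-cong (λ e → χ-∧-shift (p e) (a e) d k) L))
                                  (sym (shiftCoeff-sum d (λ e k → χ (p e ∧ (a e ≡ᵇ k))) L k))

sumRange-∑< : ∀ a b f → sumRange a b f ≡ ∑< (b ∸ a) (λ t → f (a + t))
sumRange-∑< a b f = cong sum (map-upTo (λ t → f (a + t)) (b ∸ a))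

sumRange-cong : ∀ {a b} {f g : ℕ → ℕ} → a ≤ b → (∀ j → a ≤ j → j < b → f j ≡ g j) →
  sumRange a b f ≡ sumRange a b g
sumRange-cong {a} {b} {f} {g} a≤b eq = begin
  sumRange a b f                    ≡⟨ sumRange-∑< a b f ⟩
  ∑< (b ∸ a) (λ t → f (a + t))      ≡⟨ ∑<-cong (b ∸ a) (λ t t< → eq (a + t) (m≤m+n a t) (a+t<b t t<)) ⟩
  ∑< (b ∸ a) (λ t → g (a + t))      ≡⟨ sym (sumRange-∑< a b g) ⟩
  sumRange a b g                    ∎
  where
  open ≡-Reasoning
  a+t<b : ∀ t → t < b ∸ a → a + t < b
  a+t<b t t< = subst (_< b) (+-comm t a) (m≤o∸n⇒m+n≤o (suc t) a≤b t<)

sumRange-split : ∀ {a b c} (f : ℕ → ℕ) → a ≤ b → b ≤ c →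
  sumRange a c f ≡ sumRange a b f + sumRange b c f
sumRange-split {a} {b} {c} f a≤b b≤c = begin
  sumRange a c f
    ≡⟨ sumRange-∑< a c f ⟩
  ∑< (c ∸ a) (λ t → f (a + t))
    ≡⟨ cong (λ n → ∑< n (λ t → f (a + t))) c∸a ⟩
  ∑< ((b ∸ a) + (c ∸ b)) (λ t → f (a + t))
    ≡⟨ ∑<-+-split (b ∸ a) (c ∸ b) (λ t → f (a + t)) ⟩
  ∑< (b ∸ a) (λ t → f (a + t)) + ∑< (c ∸ b) (λ t → f (a + (b ∸ a + t)))
    ≡⟨ cong₂ _+_ (sym (sumRange-∑< a b f)) (∑<-cong (c ∸ b) (λ t _ → cong f (shift t))) ⟩
  sumRange a b f + ∑< (c ∸ b) (λ t → f (b + t))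
    ≡⟨ cong (sumRange a b f +_) (sym (sumRange-∑< b c f)) ⟩
  sumRange a b f + sumRange b c f ∎
  where
  open ≡-Reasoning
  shift : ∀ t → a + (b ∸ a + t) ≡ b + t
  shift t = trans (sym (+-assoc a (b ∸ a) t)) (cong (_+ t) (m+[n∸m]≡n a≤b))
  c∸a : c ∸ a ≡ (b ∸ a) + (c ∸ b)
  c∸a = trans (cong (_∸ a) (sym (m+[n∸m]≡n b≤c))) (+-∸-comm (c ∸ b) a≤b)

sumRange-shiftCoeff : ∀ {a b} d {w : ℕ → ℕ} (F : ℕ → ℕ → ℕ) k → a ≤ b →
  (∀ j → a ≤ j → j < b → w j ≡ d) →
  sumRange a b (λ j → shiftCoeff (w j) (F j) k) ≡ shiftCoeff d (λ k → sumRange a b (λ j → F j k)) k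
sumRange-shiftCoeff {a} {b} d F k a≤b w≡d =
  trans (sumRange-cong a≤b (λ j a≤j j<b → cong (λ w → shiftCoeff w (F j) k) (w≡d j a≤j j<b)))
        (sym (shiftCoeff-sum d (λ t → F (a + t)) (upTo (b ∸ a)) k))

≡ᵇ-comm : ∀ m n → (m ≡ᵇ n) ≡ (n ≡ᵇ m)
≡ᵇ-comm zero    zero    = refl
≡ᵇ-comm zero    (suc n) = refl
≡ᵇ-comm (suc m) zero    = refl
≡ᵇ-comm (suc m) (suc n) = ≡ᵇ-comm m n

lastE-snoc : ∀ e y → lastE (e ++ [ y ]) ≡ y
lastE-snoc e y rewrite reverse-++ e [ y ] = refl

penE-snoc : ∀ e y → penE (e ++ [ y ]) ≡ lastE e
penE-snoc e y rewrite reverse-++ e [ y ] with reverse e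
... | []    = refl
... | _ ∷ _ = refl

lastE-∷ : ∀ a b r → lastE (a ∷ b ∷ r) ≡ lastE (b ∷ r)
lastE-∷ a b r rewrite unfold-reverse a (b ∷ r) | unfold-reverse b r with reverse r
... | []    = refl
... | _ ∷ _ = refl

ascsFrom-snoc : ∀ p a r y → ascsFrom p ((a ∷ r) ++ [ y ]) ≡
  ascsFrom p (a ∷ r) + χ (lastE (a ∷ r) * suc (p + length r) <ᵇ y * (p + length r))
ascsFrom-snoc p a []      y rewrite +-identityʳ p = +-identityʳ _
ascsFrom-snoc p a (b ∷ r) y rewrite ascsFrom-snoc (suc p) b r y | lastE-∷ a b r | +-suc p (length r) =
  sym (+-assoc (χ (a * suc p <ᵇ b * p)) _ _)

ascD-snoc : ∀ e y → 2 ≤ length e →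
  ascD (e ++ [ y ]) ≡ ascD e + χ (lastE e * suc (length e) <ᵇ y * length e)
ascD-snoc e@(a ∷ b ∷ r) y (s≤s (s≤s z≤n)) =
  trans (cong (asc0 e +_) (ascsFrom-snoc 1 a (b ∷ r) y)) (sym (+-assoc (asc0 e) _ _))

-- Cross-multiplied forms of j/m < x/(m+1) and j/m + x/(m+1) < (2m+1)/(m+1).
appendAscent appendBonus appendWeight : ℕ → ℕ → ℕ → ℕ
appendAscent m j x = χ (j * suc m <ᵇ x * m)
appendBonus  m j x = χ (suc m * j + m * x <ᵇ (2 * suc m ∸ 1) * m)
appendWeight m j x = appendAscent m j x + appendBonus m j x

ascDt-snoc : ∀ {m} e y → length e ≡ m → 2 ≤ m →
  ascDt (suc m) (e ++ [ y ]) ≡ appendWeight m (lastE e) y + ascD e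
ascDt-snoc e y refl 2≤m = begin
  ascD (e ++ [ y ]) + tildeBonus (suc m) (e ++ [ y ])
    ≡⟨ cong₂ _+_ (ascD-snoc e y 2≤m) tildeBonus-snoc ⟩
  ascD e + appendAscent m (lastE e) y + appendBonus m (lastE e) y
    ≡⟨ +-assoc (ascD e) _ _ ⟩
  ascD e + appendWeight m (lastE e) y
    ≡⟨ +-comm (ascD e) _ ⟩
  appendWeight m (lastE e) y + ascD e ∎
  where
  open ≡-Reasoning
  m : ℕ
  m = length e
  tildeBonus-snoc : tildeBonus (suc m) (e ++ [ y ]) ≡ appendBonus m (lastE e) y
  tildeBonus-snoc rewrite penE-snoc e y | lastE-snoc e y = refl

I-length : ∀ m → All (λ e → length e ≡ m) (I m)
I-length zero    = refl ∷ []
I-length (suc m) = concat⁺ (map⁺ (All.map (λ {e} len → map⁺ (applyUpTo⁺₂ (λ y → y) _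
  (λ y → trans (length-++ e) (trans (+-comm (length e) 1) (cong suc len))))) (I-length m)))

I-lastE< : ∀ m → All (λ e → lastE e < 2 * suc m) (I (suc m))
I-lastE< m = concat⁺ (map⁺ (All.universal
  (λ e → map⁺ (applyUpTo⁺₁ (λ y → y) _ (λ {y} y< → subst (_< 2 * suc m) (sym (lastE-snoc e y)) y<)))
  (I m)))

<ᵇ-true : ∀ {a b} → a < b → (a <ᵇ b) ≡ true
<ᵇ-true {a} {b} a<b with a <ᵇ b | <ᵇ-reflects-< a b
... | true  | _        = refl
... | false | ofⁿ a≮b = ⊥-elim (a≮b a<b)

<ᵇ-false : ∀ {a b} → b ≤ a → (a <ᵇ b) ≡ false
<ᵇ-false {a} {b} b≤a with a <ᵇ b | <ᵇ-reflects-< a b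
... | false | _        = refl
... | true  | ofʸ a<b = ⊥-elim (<⇒≱ a<b b≤a)

<ᵇ-cong : ∀ {a b c d} → (a < b → c < d) → (c < d → a < b) → (a <ᵇ b) ≡ (c <ᵇ d)
<ᵇ-cong {a} {b} {c} {d} to from with a <ᵇ b | <ᵇ-reflects-< a b | c <ᵇ d | <ᵇ-reflects-< c d
... | true  | _        | true  | _        = refl
... | false | _        | false | _        = refl
... | true  | ofʸ a<b | false | ofⁿ c≮d = ⊥-elim (c≮d (to a<b))
... | false | ofⁿ a≮b | true  | ofʸ c<d = ⊥-elim (a≮b (from c<d))

<ᵇ-∸ : ∀ {a X Y} → Y ≤ X → (a <ᵇ X ∸ Y) ≡ (a + Y <ᵇ X)
<ᵇ-∸ {a} Y≤X = <ᵇ-cong (m≤o∸n⇒m+n≤o (suc a) Y≤X) (m+n≤o⇒m≤o∸n (suc a))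

+-∸-<ᵇ : ∀ {a X Y} → Y ≤ X → (a + (X ∸ Y) <ᵇ X) ≡ (a <ᵇ Y)
+-∸-<ᵇ {a} {X} {Y} Y≤X = trans (sym (<ᵇ-∸ (m∸n≤m X Y))) (cong (a <ᵇ_) (m∸[m∸n]≡n Y≤X))

∸-swap : ∀ a b c → a ∸ b ∸ c ≡ a ∸ c ∸ b
∸-swap a b c = trans (∸-+-assoc a b c) (trans (cong (a ∸_) (+-comm b c)) (sym (∸-+-assoc a c b)))

2[1+m]∸1≡1+2m : ∀ m → 2 * suc m ∸ 1 ≡ suc (2 * m)
2[1+m]∸1≡1+2m m = cong (_∸ 1) (*-suc 2 m)

x+x≤2m : ∀ {x m} → x ≤ m → x + x ≤ 2 * m
x+x≤2m x≤m = +-mono-≤ x≤m (≤-trans x≤m (≤-reflexive (sym (+-identityʳ _))))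

appendAscent-<ᵇ : ∀ {m j x} → x ≤ m → appendAscent m j x ≡ χ (j <ᵇ x)
appendAscent-<ᵇ {m} {j} {x} x≤m =
  cong χ (<ᵇ-cong (λ p → ≰⇒> (λ x≤j → <⇒≱ p (*-mono-≤ x≤j (n≤1+n m)))) ascent)
  where
  open ≤-Reasoning
  ascent : j < x → j * suc m < x * m
  ascent j<x = begin-strict
    j * suc m  ≡⟨ *-suc j m ⟩
    j + j * m  <⟨ +-monoˡ-< (j * m) (<-≤-trans j<x x≤m) ⟩
    suc j * m  ≤⟨ *-monoˡ-≤ m j<x ⟩
    x * m      ∎

appendBonus-<ᵇ : ∀ {m j x} → x ≤ m → appendBonus m j x ≡ χ (j + x <ᵇ 2 * m)
appendBonus-<ᵇ {m} {j} {x} x≤m = cong χ (<ᵇ-cong (λ p → ≰⇒> (λ 2m≤ → <⇒≱ p (no-bonus 2m≤))) bonus)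
  where
  open ≤-Reasoning
  s : ℕ
  s = j + x
  lhs : suc m * j + m * x ≡ j + m * s
  lhs = trans (+-assoc j (m * j) (m * x)) (cong (j +_) (sym (*-distribˡ-+ m j x)))
  rhs : (2 * suc m ∸ 1) * m ≡ m + m * (2 * m)
  rhs = trans (cong (_* m) (2[1+m]∸1≡1+2m m)) (cong (m +_) (*-comm (2 * m) m))
  bonus : s < 2 * m → suc m * j + m * x < (2 * suc m ∸ 1) * m
  bonus s<2m = begin-strict
    suc m * j + m * x  ≡⟨ lhs ⟩
    j + m * s          ≤⟨ +-monoˡ-≤ (m * s) (m≤m+n j x) ⟩
    s + m * s          <⟨ +-monoˡ-< (m * s) s<2m ⟩
    2 * m + m * s      ≡⟨ +-assoc m (1 * m) (m * s) ⟩
    m + (1 * m + m * s) ≡⟨ cong (m +_) (trans (cong (_+ m * s) (*-identityˡ m)) (sym (*-suc m s))) ⟩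
    m + m * suc s      ≤⟨ +-monoʳ-≤ m (*-monoʳ-≤ m s<2m) ⟩
    m + m * (2 * m)    ≡⟨ sym rhs ⟩
    (2 * suc m ∸ 1) * m ∎
  no-bonus : 2 * m ≤ s → (2 * suc m ∸ 1) * m ≤ suc m * j + m * x
  no-bonus 2m≤s = begin
    (2 * suc m ∸ 1) * m ≡⟨ rhs ⟩
    m + m * (2 * m)     ≤⟨ +-mono-≤ m≤j (*-monoʳ-≤ m 2m≤s) ⟩
    j + m * s           ≡⟨ sym lhs ⟩
    suc m * j + m * x   ∎
    where
    m≤j : m ≤ j
    m≤j = +-cancelʳ-≤ m m j (≤-trans (≤-trans (x+x≤2m {m} ≤-refl) 2m≤s) (+-monoʳ-≤ j x≤m))

appendWeight-low : ∀ {m j x} → x ≤ m → j < x → appendWeight m j x ≡ 2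
appendWeight-low {m} {j} {x} x≤m j<x
  rewrite appendAscent-<ᵇ {m} {j} x≤m | appendBonus-<ᵇ {m} {j} x≤m
        | <ᵇ-true j<x | <ᵇ-true (<-≤-trans (+-monoˡ-< x j<x) (x+x≤2m x≤m)) = refl

appendWeight-mid : ∀ {m j x} → x ≤ m → x ≤ j → j + x < 2 * m → appendWeight m j x ≡ 1
appendWeight-mid {m} {j} x≤m x≤j j+x<2m
  rewrite appendAscent-<ᵇ {m} {j} x≤m | appendBonus-<ᵇ {m} {j} x≤m
        | <ᵇ-false x≤j | <ᵇ-true j+x<2m = refl

appendWeight-high : ∀ {m j x} → x ≤ m → 2 * m ≤ j + x → appendWeight m j x ≡ 0
appendWeight-high {m} {j} {x} x≤m 2m≤j+x
  rewrite appendAscent-<ᵇ {m} {j} x≤m | appendBonus-<ᵇ {m} {j} x≤m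
        | <ᵇ-false (+-cancelʳ-≤ x x j (≤-trans (x+x≤2m x≤m) 2m≤j+x)) | <ᵇ-false 2m≤j+x = refl

appendWeight-reflect : ∀ {m j x} → x ≤ 2 * suc m ∸ 1 →
  appendWeight m j (2 * suc m ∸ 1 ∸ x) ≡ appendWeight m j x
appendWeight-reflect {m} {j} {x} x≤W =
  trans (cong₂ _+_ (cong χ ascent≡bonus) (cong χ bonus≡ascent)) (+-comm (appendBonus m j x) _)
  where
  open ≡-Reasoning
  W : ℕ
  W = 2 * suc m ∸ 1
  ascent≡bonus : (j * suc m <ᵇ (W ∸ x) * m) ≡ (suc m * j + m * x <ᵇ W * m)
  ascent≡bonus = begin
    (j * suc m <ᵇ (W ∸ x) * m)     ≡⟨ cong (j * suc m <ᵇ_) (*-distribʳ-∸ m W x) ⟩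
    (j * suc m <ᵇ W * m ∸ x * m)   ≡⟨ <ᵇ-∸ (*-monoˡ-≤ m x≤W) ⟩
    (j * suc m + x * m <ᵇ W * m)   ≡⟨ cong₂ (λ u v → u + v <ᵇ W * m) (*-comm j (suc m)) (*-comm x m) ⟩
    (suc m * j + m * x <ᵇ W * m)   ∎
  bonus≡ascent : (suc m * j + m * (W ∸ x) <ᵇ W * m) ≡ (j * suc m <ᵇ x * m)
  bonus≡ascent = begin
    (suc m * j + m * (W ∸ x) <ᵇ W * m)
      ≡⟨ cong₂ (λ u v → suc m * j + u <ᵇ v) (*-distribˡ-∸ m W x) (*-comm W m) ⟩
    (suc m * j + (m * W ∸ m * x) <ᵇ m * W) ≡⟨ +-∸-<ᵇ (*-monoʳ-≤ m x≤W) ⟩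
    (suc m * j <ᵇ m * x)                   ≡⟨ cong₂ _<ᵇ_ (*-comm (suc m) j) (*-comm m x) ⟩
    (j * suc m <ᵇ x * m)                   ∎

Tt-suc : ∀ {m} x k → 2 ≤ m → x < 2 * suc m →
  Tt (suc m) x k ≡ sum (map (λ e → χ (appendWeight m (lastE e) x + ascD e ≡ᵇ k)) (I m))
Tt-suc {m} x k 2≤m x<N =
  trans (sum-map-concatMap F extensions (I m))
        (cong sum (map-cong-local (All.map (λ {e} len → pick-last e len) (I-length m))))
  where
  N : ℕ
  N = 2 * suc m
  F : List ℕ → ℕ
  F e = χ ((lastE e ≡ᵇ x) ∧ (ascDt (suc m) e ≡ᵇ k))
  extensions : List ℕ → List (List ℕ)
  extensions e = map (λ y → e ++ [ y ]) (upTo N)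
  pick-last : ∀ e → length e ≡ m →
    sum (map F (extensions e)) ≡ χ (appendWeight m (lastE e) x + ascD e ≡ᵇ k)
  pick-last e len = begin
    sum (map F (extensions e))
      ≡⟨ cong sum (sym (map-∘ (upTo N))) ⟩
    sum (map (λ y → F (e ++ [ y ])) (upTo N))
      ≡⟨ cong sum (map-cong (λ y → cong₂ (λ u v → χ (u ∧ (v ≡ᵇ k)))
           (trans (cong (_≡ᵇ x) (lastE-snoc e y)) (≡ᵇ-comm y x)) (ascDt-snoc e y len 2≤m)) (upTo N)) ⟩
    sum (map (λ y → χ ((x ≡ᵇ y) ∧ (appendWeight m (lastE e) y + ascD e ≡ᵇ k))) (upTo N))
      ≡⟨ cong sum (map-upTo _ N) ⟩
    ∑< N (λ y → χ ((x ≡ᵇ y) ∧ (appendWeight m (lastE e) y + ascD e ≡ᵇ k)))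
      ≡⟨ ∑<-pick N x (λ y → appendWeight m (lastE e) y + ascD e ≡ᵇ k) x<N ⟩
    χ (appendWeight m (lastE e) x + ascD e ≡ᵇ k) ∎
    where open ≡-Reasoning

Tt-expansion : ∀ {m} x k → 2 ≤ m → x < 2 * suc m →
  Tt (suc m) x k ≡ sumRange 0 (2 * m) (λ j → shiftCoeff (appendWeight m j x) (T m j) k)
Tt-expansion {m@(suc m')} x k 2≤m x<N = begin
  Tt (suc m) x k
    ≡⟨ Tt-suc x k 2≤m x<N ⟩
  sum (map (λ e → χ (appendWeight m (lastE e) x + ascD e ≡ᵇ k)) (I m))
    ≡⟨ sum-map-fibres lastE (λ e j → appendWeight m j x + ascD e ≡ᵇ k) (I-lastE< m') ⟩
  ∑< (2 * m) (λ j → sum (map (λ e → χ ((lastE e ≡ᵇ j) ∧ (appendWeight m j x + ascD e ≡ᵇ k))) (I m)))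
    ≡⟨ ∑<-cong (2 * m) (λ j _ → sum-map-χ-shift (λ e → lastE e ≡ᵇ j) ascD (appendWeight m j x) k (I m)) ⟩
  ∑< (2 * m) (λ j → shiftCoeff (appendWeight m j x) (T m j) k)
    ≡⟨ sym (sumRange-∑< 0 (2 * m) _) ⟩
  sumRange 0 (2 * m) (λ j → shiftCoeff (appendWeight m j x) (T m j) k) ∎
  where open ≡-Reasoning

Tt-three-ranges : ∀ {m} x k → 2 ≤ m → x ≤ m →
  Tt (suc m) x k ≡ shiftCoeff 2 (λ k → sumRange 0 x (λ j → T m j k)) k
                 + shiftCoeff 1 (λ k → sumRange x (2 * m ∸ x) (λ j → T m j k)) k
                 + sumRange (2 * m ∸ x) (2 * m) (λ j → T m j k)
Tt-three-ranges {m} x k 2≤m x≤m = begin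
  Tt (suc m) x k
    ≡⟨ Tt-expansion x k 2≤m (≤-<-trans x≤m (m<n⇒m<1+n (m<m+n m z<s))) ⟩
  sumRange 0 L H
    ≡⟨ sumRange-split H z≤n U≤L ⟩
  sumRange 0 U H + sumRange U L H
    ≡⟨ cong (_+ sumRange U L H) (sumRange-split H z≤n x≤U) ⟩
  sumRange 0 x H + sumRange x U H + sumRange U L H
    ≡⟨ cong₂ _+_ (cong₂ _+_ low mid) high ⟩
  shiftCoeff 2 (λ k → sumRange 0 x (λ j → T m j k)) k
    + shiftCoeff 1 (λ k → sumRange x U (λ j → T m j k)) k
    + sumRange U L (λ j → T m j k) ∎
  where
  open ≡-Reasoning
  L : ℕ
  L = 2 * m
  U : ℕ
  U = 2 * m ∸ x
  H : ℕ → ℕ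
  H j = shiftCoeff (appendWeight m j x) (T m j) k
  x≤L : x ≤ L
  x≤L = ≤-trans (m≤m+n x x) (x+x≤2m x≤m)
  x≤U : x ≤ U
  x≤U = m+n≤o⇒m≤o∸n x (x+x≤2m x≤m)
  U≤L : U ≤ L
  U≤L = m∸n≤m L x
  below-U : ∀ {j} → j < U → j + x < L
  below-U j<U = m≤o∸n⇒m+n≤o (suc _) x≤L j<U
  above-U : ∀ {j} → U ≤ j → L ≤ j + x
  above-U {j} U≤j = subst (_≤ j + x) (m∸n+n≡m x≤L) (+-monoˡ-≤ x U≤j)
  low : sumRange 0 x H ≡ shiftCoeff 2 (λ k → sumRange 0 x (λ j → T m j k)) k
  low = sumRange-shiftCoeff 2 (T m) k z≤n (λ j _ j<x → appendWeight-low x≤m j<x)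
  mid : sumRange x U H ≡ shiftCoeff 1 (λ k → sumRange x U (λ j → T m j k)) k
  mid = sumRange-shiftCoeff 1 (T m) k x≤U (λ j x≤j j<U → appendWeight-mid x≤m x≤j (below-U j<U))
  high : sumRange U L H ≡ sumRange U L (λ j → T m j k)
  high = sumRange-shiftCoeff 0 (T m) k U≤L (λ j U≤j _ → appendWeight-high x≤m (above-U U≤j))

Tt-reflect : ∀ {m} x k → 2 ≤ m → x ≤ 2 * suc m ∸ 1 → Tt (suc m) (2 * suc m ∸ 1 ∸ x) k ≡ Tt (suc m) x k
Tt-reflect {m} x k 2≤m x≤W = begin
  Tt (suc m) (W ∸ x) k
    ≡⟨ Tt-expansion (W ∸ x) k 2≤m (≤-<-trans (m∸n≤m W x) W<N) ⟩
  sumRange 0 (2 * m) (λ j → shiftCoeff (appendWeight m j (W ∸ x)) (T m j) k)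
    ≡⟨ cong sum (map-cong (λ j → cong (λ w → shiftCoeff w (T m j) k) (appendWeight-reflect {m} {j} x≤W))
                          (upTo (2 * m))) ⟩
  sumRange 0 (2 * m) (λ j → shiftCoeff (appendWeight m j x) (T m j) k)
    ≡⟨ sym (Tt-expansion x k 2≤m (≤-<-trans x≤W W<N)) ⟩
  Tt (suc m) x k ∎
  where
  open ≡-Reasoning
  W : ℕ
  W = 2 * suc m ∸ 1
  W<N : W < 2 * suc m
  W<N = subst₂ _<_ (sym (2[1+m]∸1≡1+2m m)) (sym (*-suc 2 m)) (n<1+n _)

lemma4p1 : (n i : ℕ) → 3 ≤ n → i ≤ n ∸ 1 →
    ((k : ℕ) → Tt n i k ≡
        shiftCoeff 2 (λ m → sumRange 0 i (λ j → T (n ∸ 1) j m)) k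
      + shiftCoeff 1 (λ m → sumRange i (2 * n ∸ i ∸ 2) (λ j → T (n ∸ 1) j m)) k
      + sumRange (2 * n ∸ i ∸ 2) (2 * n ∸ 2) (λ j → T (n ∸ 1) j k))
    × ((k : ℕ) → Tt n (2 * n ∸ i ∸ 1) k ≡ Tt n i k)
lemma4p1 (suc m) i (s≤s 2≤m@(s≤s (s≤s z≤n))) i≤m = three-ranges , reflection
  where
  2[1+m]∸2≡2m : 2 * suc m ∸ 2 ≡ 2 * m
  2[1+m]∸2≡2m = cong (_∸ 2) (*-suc 2 m)
  three-ranges : ∀ k → Tt (suc m) i k ≡
      shiftCoeff 2 (λ k → sumRange 0 i (λ j → T m j k)) k
    + shiftCoeff 1 (λ k → sumRange i (2 * suc m ∸ i ∸ 2) (λ j → T m j k)) k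
    + sumRange (2 * suc m ∸ i ∸ 2) (2 * suc m ∸ 2) (λ j → T m j k)
  three-ranges k = trans (Tt-three-ranges i k 2≤m i≤m)
    (cong₂ (λ U L → shiftCoeff 2 (λ k → sumRange 0 i (λ j → T m j k)) k
                  + shiftCoeff 1 (λ k → sumRange i U (λ j → T m j k)) k
                  + sumRange U L (λ j → T m j k))
           (sym (trans (∸-swap (2 * suc m) i 2) (cong (_∸ i) 2[1+m]∸2≡2m))) (sym 2[1+m]∸2≡2m))
  reflection : ∀ k → Tt (suc m) (2 * suc m ∸ i ∸ 1) k ≡ Tt (suc m) i k
  reflection k = trans (cong (λ x → Tt (suc m) x k) (∸-swap (2 * suc m) i 1)) (Tt-reflect i k 2≤m i≤W)
    where
    i≤W : i ≤ 2 * suc m ∸ 1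
    i≤W = subst (i ≤_) (sym (2[1+m]∸1≡1+2m m)) (m≤n⇒m≤1+n (≤-trans i≤m (m≤m+n m _)))
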